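{- Let $D=(V,A)$ be an oriented graph (a digraph with no loops, no parallel arcs and no directed 2-cycles) with $n=|V|$, in which every arc $ij\in A$ has a positive integral weight $w_{ij}$. Let $\alpha:V\to\{1,\dots,n\}$ be a bijection chosen uniformly at random, and define $X(\alpha)=\frac12\sum_{ij\in A}\epsilon_{ij}(\alpha)$, where $\epsilon_{ij}(\alpha)=w_{ij}$ if $\alpha(i)<\alpha(j)$ and $\epsilon_{ij}(\alpha)=-w_{ij}$ otherwise. Let $W^{(2)}=\sum_{ij\in A}w_{ij}^2$. Then $\mathbb{E}(X^2)\ge W^{(2)}/12$. -}

module Defs where

open import Data.Nat as ℕ using (ℕ; zero; suc)
open import Data.Fin using (Fin; zero; suc; _<?_; _≟_)
open import Data.Integer using (ℤ; +_; -_; _+_; _*_)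
open import Data.Bool using (Bool; true; false; if_then_else_; _∨_; not)
open import Data.Bool.ListAction using (and)
open import Data.List as List using (List; []; _∷_; [_]; concatMap; map; filterᵇ; length; allFin)
open import Data.Vec using (Vec; []; _∷_; lookup)
open import Relation.Nullary.Decidable using (⌊_⌋)
open import Relation.Binary.PropositionalEquality using (_≡_)

sumFin : ∀ {n} → (Fin n → ℤ) → ℤ
sumFin {zero}  f = + 0
sumFin {suc n} f = f zero + sumFin (λ i → f (suc i))

sumList : ∀ {A : Set} → (A → ℤ) → List A → ℤ
sumList f []       = + 0
sumList f (x ∷ xs) = f x + sumList f xs

-- Adjacency as a function excludes parallel arcs.
-- The weight is only relevant on arcs, where it is a positive integer.
record WeightedOrientedGraph (n : ℕ) : Set where
  field
    arc        : Fin n → Fin n → Bool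
    weight     : Fin n → Fin n → ℕ
    loopless   : ∀ i → arc i i ≡ false
    no2cycle   : ∀ i j → arc i j ≡ true → arc j i ≡ false
    weight-pos : ∀ i j → arc i j ≡ true → 1 ℕ.≤ weight i j
open WeightedOrientedGraph public

allMaps : (k m : ℕ) → List (Vec (Fin m) k)
allMaps zero    m = [ [] ]
allMaps (suc k) m = concatMap (λ v → map (λ x → x ∷ v) (allFin m)) (allMaps k m)

injectiveᵇ : ∀ {k m} → Vec (Fin m) k → Bool
injectiveᵇ {k} v =
  and (concatMap (λ i → map (λ j → ⌊ i ≟ j ⌋ ∨ not ⌊ lookup v i ≟ lookup v j ⌋) (allFin k)) (allFin k))

-- All bijections α : V → {1,…,n}, with {1,…,n} represented by Fin n
-- (order-preserving relabelling i ↦ i+1).  Injective self-maps of a finite set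
-- are exactly the bijections.
bijections : (n : ℕ) → List (Vec (Fin n) n)
bijections n = filterᵇ injectiveᵇ (allMaps n n)

epsilon : ∀ {n} → WeightedOrientedGraph n → Vec (Fin n) n → Fin n → Fin n → ℤ
epsilon D α i j =
  if ⌊ lookup α i <? lookup α j ⌋ then + weight D i j else - (+ weight D i j)

twiceX : ∀ {n} → WeightedOrientedGraph n → Vec (Fin n) n → ℤ
twiceX D α = sumFin (λ i → sumFin (λ j → if arc D i j then epsilon D α i j else + 0))

W2 : ∀ {n} → WeightedOrientedGraph n → ℤ
W2 D = sumFin (λ i → sumFin (λ j → if arc D i j then + (weight D i j ℕ.* weight D i j) else + 0))

-- Σ_α (2X(α))² = 4 · Σ_α X(α)², summed over all bijections α.
sumFourXsq : ∀ {n} → WeightedOrientedGraph n → ℤ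
sumFourXsq {n} D = sumList (λ α → twiceX D α * twiceX D α) (bijections n)

-- Write σ_α(i,j) = ±1 according as α(i) < α(j), so that 2X(α) = Σ_ij w_ij σ_α(i,j), and let
-- C(ij,kl) = Σ_α σ_α(i,j) σ_α(k,l), summed over all n! bijections α.  Composing α with a
-- transposition of the vertices permutes the bijections, so C is invariant under relabelling;
-- together with σ_α(j,i) = -σ_α(i,j) this gives C = n! for kl = ij, C = 0 for disjoint arcs, and
-- C(ij,il) = n!/3, because the relabelled copies C(ij,il), C(ji,jl), C(li,lj) are equal and, for
-- each α, the three products add up to 1.  Summing over pairs of arcs (where the absence of loops
-- and 2-cycles removes the remaining terms),
--   3 Σ_α (2X(α))² = n! (W⁽²⁾ + Σ_v (d⁺(v) - d⁻(v))²)
-- with d± the weighted out- and in-degrees; hence E(X²) = (W⁽²⁾ + Σ_v (d⁺(v) - d⁻(v))²)/12.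
module Submission where

open import Defs
open import Data.Bool using (true; false; T; _∨_; not; if_then_else_)
open import Data.Bool.ListAction using (and)
open import Data.Bool.Properties using (T?)
open import Data.Fin using (Fin; zero; suc; _<_; _<?_; _≟_)
open import Data.Fin.Permutation using (Permutation′; _⟨$⟩ʳ_; _⟨$⟩ˡ_; inverseˡ; inverseʳ; transpose)
open import Data.Fin.Properties using (<-cmp; <-asym; <-trans)
open import Data.Integer using (ℤ; +_; -[1+_]; -_; _+_; _*_; _-_; _≤_; +≤+; 0ℤ; 1ℤ; -1ℤ; nonNegative)
open import Data.Integer.Properties
  using ( +-*-semiring; +-*-ring; +-commutativeSemigroup; *-commutativeSemigroup
        ; +-assoc; +-comm; +-identityˡ; +-identityʳ; +-mono-≤
        ; *-assoc; *-comm; *-identityˡ; *-identityʳ; *-zeroʳ; *-distribˡ-+; *-monoˡ-≤-nonNeg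
        ; neg-distrib-+; neg-distribˡ-*; neg-distribʳ-*; neg-involutive; pos-*; i≤i+j
        ; module ≤-Reasoning )
open import Data.Integer.Tactic.RingSolver using (solve-∀)
open import Data.List using (List; []; _∷_; _++_; map; concatMap; allFin; length; cartesianProductWith)
open import Data.List.Membership.Propositional using (_∈_)
open import Data.List.Membership.Propositional.Properties
  using (∈-map⁺; ∈-map⁻; ∈-concatMap⁺; ∈-allFin; ∈-filter⁺; ∈-filter⁻)
open import Data.List.Membership.Propositional.Properties.WithK using (unique∧set⇒bag)
open import Data.List.Relation.Binary.BagAndSetEquality using (∼bag⇒↭)
open import Data.List.Relation.Binary.Permutation.Propositional using (_↭_; refl; prep; swap; trans)
open import Data.List.Relation.Unary.All using (All; []; _∷_)
import Data.List.Relation.Unary.All.Properties as All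
open import Data.List.Relation.Unary.AllPairs using ([]; _∷_)
open import Data.List.Relation.Unary.Any as Any using (here; there)
open import Data.List.Relation.Unary.Unique.Propositional using (Unique)
import Data.List.Relation.Unary.Unique.Propositional.Properties as Unique
open import Data.Nat as ℕ using (ℕ; zero; suc)
open import Data.Product using (_,_; proj₂)
open import Data.Vec as Vec using (Vec; lookup; tabulate)
open import Data.Vec.Functional using (replicate)
open import Data.Vec.Properties using (∷-injective; lookup∘tabulate; tabulate∘lookup; tabulate-cong)
open import Function using (_∘_; _⇔_; mk⇔; Equivalence)
open import Function.Definitions using (Injective)
open import Relation.Binary.Definitions using (tri<; tri≈; tri>)
open import Relation.Binary.PropositionalEquality
  using (_≡_; _≢_; refl; sym; cong; cong₂; subst; module ≡-Reasoning)
  renaming (trans to ≡-trans)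
open import Relation.Nullary using (Dec; does; yes; no)
open import Relation.Nullary.Decidable using (⌊_⌋; dec-true; dec-false)
open import Relation.Nullary.Negation using (contradiction)

open import Algebra.Properties.CommutativeSemigroup +-commutativeSemigroup
  using () renaming (interchange to +-interchange)
open import Algebra.Properties.CommutativeSemigroup *-commutativeSemigroup
  using () renaming (interchange to *-interchange; x∙yz≈y∙xz to *-leftSwap; x∙yz≈y∙zx to *-rotate)
open import Algebra.Properties.Ring +-*-ring using (x[y-z]≈xy-xz; [y-z]x≈yx-zx)
open import Algebra.Properties.Semiring.Sum +-*-semiring
  using ( sum; sum-syntax; sum-cong-≗; sum-replicate-zero; ∑-distrib-+; ∑-comm
        ; *-distribˡ-sum; *-distribʳ-sum )

sumList-cong : ∀ {A : Set} {f g : A → ℤ} (xs : List A) →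
  (∀ {x} → x ∈ xs → f x ≡ g x) → sumList f xs ≡ sumList g xs
sumList-cong []       f≡g = refl
sumList-cong (x ∷ xs) f≡g = cong₂ _+_ (f≡g (here refl)) (sumList-cong xs (f≡g ∘ there))

sumList-map : ∀ {A B : Set} (f : B → ℤ) (g : A → B) xs →
  sumList f (map g xs) ≡ sumList (f ∘ g) xs
sumList-map f g []       = refl
sumList-map f g (x ∷ xs) = cong (_+_ (f (g x))) (sumList-map f g xs)

sumList-+ : ∀ {A : Set} (f g : A → ℤ) xs →
  sumList (λ x → f x + g x) xs ≡ sumList f xs + sumList g xs
sumList-+ f g []       = refl
sumList-+ f g (x ∷ xs) =
  ≡-trans (cong (_+_ (f x + g x)) (sumList-+ f g xs)) (+-interchange (f x) (g x) _ _)

sumList-neg : ∀ {A : Set} (f : A → ℤ) xs → sumList (λ x → - f x) xs ≡ - sumList f xs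
sumList-neg f []       = refl
sumList-neg f (x ∷ xs) =
  ≡-trans (cong (_+_ (- f x)) (sumList-neg f xs)) (sym (neg-distrib-+ (f x) (sumList f xs)))

sumList-*ˡ : ∀ {A : Set} (c : ℤ) (f : A → ℤ) xs → sumList (λ x → c * f x) xs ≡ c * sumList f xs
sumList-*ˡ c f []       = sym (*-zeroʳ c)
sumList-*ˡ c f (x ∷ xs) =
  ≡-trans (cong (_+_ (c * f x)) (sumList-*ˡ c f xs)) (sym (*-distribˡ-+ c (f x) (sumList f xs)))

sumList-1≡length : ∀ {A : Set} (xs : List A) → sumList (λ _ → 1ℤ) xs ≡ + length xs
sumList-1≡length []       = refl
sumList-1≡length (x ∷ xs) = cong (_+_ 1ℤ) (sumList-1≡length xs)

sumList-↭ : ∀ {A : Set} (f : A → ℤ) {xs ys} → xs ↭ ys → sumList f xs ≡ sumList f ys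
sumList-↭ f refl        = refl
sumList-↭ f (prep x p)  = cong (_+_ (f x)) (sumList-↭ f p)
sumList-↭ f (swap {xs} {ys} x y p) = begin
  f x + (f y + sumList f xs)  ≡⟨ sym (+-assoc (f x) (f y) _) ⟩
  f x + f y + sumList f xs    ≡⟨ cong₂ _+_ (+-comm (f x) (f y)) (sumList-↭ f p) ⟩
  f y + f x + sumList f ys    ≡⟨ +-assoc (f y) (f x) _ ⟩
  f y + (f x + sumList f ys)  ∎
  where open ≡-Reasoning
sumList-↭ f (trans p q) = ≡-trans (sumList-↭ f p) (sumList-↭ f q)

sumList-reindex : ∀ {A : Set} (f : A → ℤ) {xs} (σ τ : A → A) → Unique xs →
  (∀ x → σ (τ x) ≡ x) → (∀ x → τ (σ x) ≡ x) →
  (∀ {x} → x ∈ xs → σ x ∈ xs) → (∀ {x} → x ∈ xs → τ x ∈ xs) →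
  sumList f xs ≡ sumList (f ∘ σ) xs
sumList-reindex f {xs} σ τ xs-unique στ τσ σ∈ τ∈ =
  ≡-trans (sumList-↭ f (∼bag⇒↭ (unique∧set⇒bag xs-unique σxs-unique sameElements))) (sumList-map f σ xs)
  where
  σ-injective : ∀ {x y} → σ x ≡ σ y → x ≡ y
  σ-injective {x} {y} σx≡σy = ≡-trans (sym (τσ x)) (≡-trans (cong τ σx≡σy) (τσ y))
  σxs-unique : Unique (map σ xs)
  σxs-unique = Unique.map⁺ σ-injective xs-unique
  sameElements : ∀ {x} → x ∈ xs ⇔ x ∈ map σ xs
  sameElements {x} = mk⇔
    (λ x∈ → subst (_∈ map σ xs) (στ x) (∈-map⁺ σ (τ∈ x∈)))
    (λ x∈ → let y , y∈ , x≡σy = ∈-map⁻ σ x∈ in subst (_∈ xs) (sym x≡σy) (σ∈ y∈))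

sumFin≡sum : ∀ {n} (f : Fin n → ℤ) → sumFin f ≡ sum f
sumFin≡sum {zero}  f = refl
sumFin≡sum {suc n} f = cong (_+_ (f zero)) (sumFin≡sum (λ i → f (suc i)))

∑-neg : ∀ {n} (f : Fin n → ℤ) → ∑[ i < n ] (- f i) ≡ - ∑[ i < n ] f i
∑-neg {zero}  f = refl
∑-neg {suc n} f =
  ≡-trans (cong (_+_ (- f zero)) (∑-neg (f ∘ suc))) (sym (neg-distrib-+ (f zero) (sum (f ∘ suc))))

∑-distrib-- : ∀ {n} (f g : Fin n → ℤ) → ∑[ i < n ] (f i - g i) ≡ ∑[ i < n ] f i - ∑[ i < n ] g i
∑-distrib-- f g = ≡-trans (∑-distrib-+ f (λ i → - g i)) (cong (_+_ (sum f)) (∑-neg g))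

∑-nonNeg : ∀ {n} (f : Fin n → ℤ) → (∀ i → 0ℤ ≤ f i) → 0ℤ ≤ ∑[ i < n ] f i
∑-nonNeg {zero}  f f≥0 = +≤+ ℕ.z≤n
∑-nonNeg {suc n} f f≥0 = +-mono-≤ (f≥0 zero) (∑-nonNeg (f ∘ suc) (f≥0 ∘ suc))

sumList-∑ : ∀ {A : Set} {n} (F : A → Fin n → ℤ) xs →
  sumList (λ x → ∑[ i < n ] F x i) xs ≡ ∑[ i < n ] sumList (λ x → F x i) xs
sumList-∑ {n = n} F []       = sym (sum-replicate-zero n)
sumList-∑         F (x ∷ xs) =
  ≡-trans (cong (_+_ (sum (F x))) (sumList-∑ F xs)) (sym (∑-distrib-+ (F x) _))

δ : ∀ {n} → Fin n → Fin n → ℤ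
δ k i = if does (k ≟ i) then 1ℤ else 0ℤ

∑-δ : ∀ {n} (f : Fin n → ℤ) i → ∑[ k < n ] (δ k i * f k) ≡ f i
∑-δ {suc n} f zero    = begin
  1ℤ * f zero + ∑[ k < n ] 0ℤ   ≡⟨ cong₂ _+_ (*-identityˡ (f zero)) (sum-replicate-zero n) ⟩
  f zero + 0ℤ                   ≡⟨ +-identityʳ (f zero) ⟩
  f zero                        ∎
  where open ≡-Reasoning
∑-δ {suc n} f (suc i) = ≡-trans (+-identityˡ (∑[ k < n ] (δ k i * f (suc k)))) (∑-δ (f ∘ suc) i)

∑-[δ-δ] : ∀ {n} (f : Fin n → ℤ) i j → ∑[ v < n ] ((δ v i - δ v j) * f v) ≡ f i - f j
∑-[δ-δ] {n} f i j = begin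
  ∑[ v < n ] ((δ v i - δ v j) * f v)
    ≡⟨ sum-cong-≗ (λ v → [y-z]x≈yx-zx (f v) (δ v i) (δ v j)) ⟩
  ∑[ v < n ] (δ v i * f v - δ v j * f v)
    ≡⟨ ∑-distrib-- (λ v → δ v i * f v) (λ v → δ v j * f v) ⟩
  ∑[ v < n ] (δ v i * f v) - ∑[ v < n ] (δ v j * f v)
    ≡⟨ cong₂ _-_ (∑-δ f i) (∑-δ f j) ⟩
  f i - f j
    ∎
  where open ≡-Reasoning

∑∑ : ∀ {n} → (Fin n → Fin n → ℤ) → ℤ
∑∑ {n} f = ∑[ i < n ] ∑[ j < n ] f i j

sumFin²≡∑∑ : ∀ {n} {f g : Fin n → Fin n → ℤ} → (∀ i j → f i j ≡ g i j) →
  sumFin (λ i → sumFin (f i)) ≡ ∑∑ g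
sumFin²≡∑∑ {f = f} f≡g = ≡-trans (sumFin≡sum (λ i → sumFin (f i)))
  (sum-cong-≗ (λ i → ≡-trans (sumFin≡sum (f i)) (sum-cong-≗ (f≡g i))))

∑∑-cong : ∀ {n} {f g : Fin n → Fin n → ℤ} → (∀ i j → f i j ≡ g i j) → ∑∑ f ≡ ∑∑ g
∑∑-cong f≡g = sum-cong-≗ (λ i → sum-cong-≗ (f≡g i))

∑∑-zero : ∀ n → ∑∑ {n} (λ _ _ → 0ℤ) ≡ 0ℤ
∑∑-zero n = ≡-trans (sum-cong-≗ {y = replicate n 0ℤ} (λ _ → sum-replicate-zero n)) (sum-replicate-zero n)

∑∑-distrib-+ : ∀ {n} (f g : Fin n → Fin n → ℤ) → ∑∑ (λ i j → f i j + g i j) ≡ ∑∑ f + ∑∑ g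
∑∑-distrib-+ f g =
  ≡-trans (sum-cong-≗ (λ i → ∑-distrib-+ (f i) (g i))) (∑-distrib-+ (λ i → sum (f i)) (λ i → sum (g i)))

∑∑-distrib-- : ∀ {n} (f g : Fin n → Fin n → ℤ) → ∑∑ (λ i j → f i j - g i j) ≡ ∑∑ f - ∑∑ g
∑∑-distrib-- f g =
  ≡-trans (sum-cong-≗ (λ i → ∑-distrib-- (f i) (g i))) (∑-distrib-- (λ i → sum (f i)) (λ i → sum (g i)))

*-distribˡ-∑∑ : ∀ {n} x (f : Fin n → Fin n → ℤ) → x * ∑∑ f ≡ ∑∑ (λ i j → x * f i j)
*-distribˡ-∑∑ x f =
  ≡-trans (*-distribˡ-sum x (λ i → sum (f i))) (sum-cong-≗ (λ i → *-distribˡ-sum x (f i)))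

*-distribˡ-∑∑-weighted : ∀ {n} c (a f : Fin n → Fin n → ℤ) →
  c * ∑∑ (λ i j → a i j * f i j) ≡ ∑∑ (λ i j → a i j * (c * f i j))
*-distribˡ-∑∑-weighted c a f =
  ≡-trans (*-distribˡ-∑∑ c (λ i j → a i j * f i j)) (∑∑-cong (λ i j → *-leftSwap c (a i j) (f i j)))

∑∑-*-∑∑ : ∀ {n} (f g : Fin n → Fin n → ℤ) →
  ∑∑ f * ∑∑ g ≡ ∑∑ (λ i j → ∑∑ (λ k l → f i j * g k l))
∑∑-*-∑∑ f g = ≡-trans (*-distribʳ-sum (∑∑ g) (λ i → sum (f i)))
  (sum-cong-≗ λ i → ≡-trans (*-distribʳ-sum (∑∑ g) (f i))
    (sum-cong-≗ λ j → *-distribˡ-∑∑ (f i j) g))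

∑∑-δδ : ∀ {n} (f : Fin n → Fin n → ℤ) i j → ∑∑ (λ k l → f k l * (δ k i * δ l j)) ≡ f i j
∑∑-δδ {n} f i j = begin
  ∑∑ (λ k l → f k l * (δ k i * δ l j))
    ≡⟨ ∑∑-cong (λ k l → *-rotate (f k l) (δ k i) (δ l j)) ⟩
  ∑∑ (λ k l → δ k i * (δ l j * f k l))
    ≡⟨ sum-cong-≗ (λ k → sym (*-distribˡ-sum (δ k i) (λ l → δ l j * f k l))) ⟩
  ∑[ k < n ] (δ k i * ∑[ l < n ] (δ l j * f k l))
    ≡⟨ ∑-δ _ i ⟩
  ∑[ l < n ] (δ l j * f i l)
    ≡⟨ ∑-δ (f i) j ⟩
  f i j
    ∎
  where open ≡-Reasoning

sumList-∑∑ : ∀ {A : Set} {n} (F : A → Fin n → Fin n → ℤ) xs →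
  sumList (λ x → ∑∑ (F x)) xs ≡ ∑∑ (λ i j → sumList (λ x → F x i j) xs)
sumList-∑∑ {n = n} F xs =
  ≡-trans (sumList-∑ (λ x i → ∑[ j < n ] F x i j) xs) (sum-cong-≗ (λ i → sumList-∑ (λ x → F x i) xs))

divergence : ∀ {n} → (Fin n → Fin n → ℤ) → Fin n → ℤ
divergence {n} a v = ∑[ l < n ] a v l - ∑[ k < n ] a k v

∑∑-gradient : ∀ {n} (a : Fin n → Fin n → ℤ) (c : Fin n → ℤ) →
  ∑∑ (λ k l → a k l * (c k - c l)) ≡ ∑[ v < n ] (c v * divergence a v)
∑∑-gradient {n} a c = begin
  ∑∑ (λ k l → a k l * (c k - c l))
    ≡⟨ ∑∑-cong (λ k l → ≡-trans (x[y-z]≈xy-xz (a k l) (c k) (c l))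
                                 (cong₂ _-_ (*-comm (a k l) (c k)) (*-comm (a k l) (c l)))) ⟩
  ∑∑ (λ k l → c k * a k l - c l * a k l)
    ≡⟨ ∑∑-distrib-- (λ k l → c k * a k l) (λ k l → c l * a k l) ⟩
  ∑∑ (λ k l → c k * a k l) - ∑∑ (λ k l → c l * a k l)
    ≡⟨ cong (_-_ (∑∑ (λ k l → c k * a k l))) (∑-comm (λ k l → c l * a k l)) ⟩
  ∑[ v < n ] ∑[ l < n ] (c v * a v l) - ∑[ v < n ] ∑[ k < n ] (c v * a k v)
    ≡⟨ sym (cong₂ _-_ (sum-cong-≗ (λ v → *-distribˡ-sum (c v) (a v)))
                      (sum-cong-≗ (λ v → *-distribˡ-sum (c v) (λ k → a k v)))) ⟩
  ∑[ v < n ] (c v * ∑[ l < n ] a v l) - ∑[ v < n ] (c v * ∑[ k < n ] a k v)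
    ≡⟨ sym (∑-distrib-- (λ v → c v * ∑[ l < n ] a v l) (λ v → c v * ∑[ k < n ] a k v)) ⟩
  ∑[ v < n ] (c v * ∑[ l < n ] a v l - c v * ∑[ k < n ] a k v)
    ≡⟨ sum-cong-≗ (λ v → sym (x[y-z]≈xy-xz (c v) _ _)) ⟩
  ∑[ v < n ] (c v * divergence a v)
    ∎
  where open ≡-Reasoning

x≡-x⇒x≡0 : ∀ {x} → x ≡ - x → x ≡ 0ℤ
x≡-x⇒x≡0 {+ zero}   _  = refl
x≡-x⇒x≡0 {+ suc _}  ()
x≡-x⇒x≡0 { -[1+ _ ]} ()

3*-x≡x*-3 : ∀ x → + 3 * - x ≡ x * - + 3
3*-x≡x*-3 = solve-∀

-x≡x*-1 : ∀ x → - x ≡ x * -1ℤ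
-x≡x*-1 = solve-∀

if-neg≡*sign : ∀ b x → (if b then x else - x) ≡ x * (if b then 1ℤ else -1ℤ)
if-neg≡*sign true  x = sym (*-identityʳ x)
if-neg≡*sign false x = -x≡x*-1 x

square-nonNeg : ∀ x → 0ℤ ≤ x * x
square-nonNeg (+ m)    = subst (0ℤ ≤_) (pos-* m m) (+≤+ ℕ.z≤n)
square-nonNeg -[1+ _ ] = +≤+ ℕ.z≤n

-- Bijections and relabelling

and⇒All : ∀ bs → T (and bs) → All T bs
and⇒All []          _ = []
and⇒All (true ∷ bs) t = _ ∷ and⇒All bs t

All⇒and : ∀ {bs} → All T bs → T (and bs)
All⇒and []                  = _
All⇒and {true ∷ _} (_ ∷ ts) = All⇒and ts

T-implication : ∀ {P Q : Set} (P? : Dec P) (Q? : Dec Q) → T (⌊ P? ⌋ ∨ not ⌊ Q? ⌋) ⇔ (Q → P)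
T-implication (yes p) _       = mk⇔ (λ _ _ → p) _
T-implication (no ¬p) (yes q) = mk⇔ (λ ()) (λ q⇒p → ¬p (q⇒p q))
T-implication (no ¬p) (no ¬q) = mk⇔ (λ _ q → contradiction q ¬q) _

module _ {k m} (v : Vec (Fin m) k) where
  private
    entry : ∀ i j → T (⌊ i ≟ j ⌋ ∨ not ⌊ lookup v i ≟ lookup v j ⌋) ⇔ (lookup v i ≡ lookup v j → i ≡ j)
    entry i j = T-implication (i ≟ j) (lookup v i ≟ lookup v j)

  injectiveᵇ-sound : T (injectiveᵇ v) → Injective _≡_ _≡_ (lookup v)
  injectiveᵇ-sound t {i} {j} = Equivalence.to (entry i j)
    (All.tabulate⁻ (All.map⁻ (All.tabulate⁻ (All.map⁻ (All.concat⁻ (and⇒All _ t))) i)) j)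

  injectiveᵇ-complete : Injective _≡_ _≡_ (lookup v) → T (injectiveᵇ v)
  injectiveᵇ-complete inj = All⇒and (All.concat⁺ (All.map⁺ (All.tabulate⁺ λ i →
    All.map⁺ (All.tabulate⁺ λ j → Equivalence.from (entry i j) inj))))

allMaps-complete : ∀ {k m} (v : Vec (Fin m) k) → v ∈ allMaps k m
allMaps-complete Vec.[]                  = here refl
allMaps-complete {suc k} {m} (x Vec.∷ v) = ∈-concatMap⁺ (λ u → map (Vec._∷ u) (allFin m))
  (Any.map (λ { refl → ∈-map⁺ (Vec._∷ v) (∈-allFin x) }) (allMaps-complete v))

concatMap-map≡cartesianProductWith : ∀ {A B C : Set} (f : A → B → C) xs ys →
  concatMap (λ x → map (f x) ys) xs ≡ cartesianProductWith f xs ys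
concatMap-map≡cartesianProductWith f []       ys = refl
concatMap-map≡cartesianProductWith f (x ∷ xs) ys =
  cong (map (f x) ys ++_) (concatMap-map≡cartesianProductWith f xs ys)

allMaps-unique : ∀ k m → Unique (allMaps k m)
allMaps-unique zero    m = [] ∷ []
allMaps-unique (suc k) m =
  subst Unique (sym (concatMap-map≡cartesianProductWith (λ v x → x Vec.∷ v) (allMaps k m) (allFin m)))
    (Unique.cartesianProductWith⁺ (λ v x → x Vec.∷ v)
      (λ eq → let x≡y , v≡w = ∷-injective eq in v≡w , x≡y) (allMaps-unique k m) (Unique.allFin⁺ m))

bijections-unique : ∀ n → Unique (bijections n)
bijections-unique n = Unique.filter⁺ (T? ∘ injectiveᵇ) (allMaps-unique n n)

∈-bijections⁻ : ∀ {n} {α : Vec (Fin n) n} → α ∈ bijections n → Injective _≡_ _≡_ (lookup α)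
∈-bijections⁻ {n} {α} α∈ = injectiveᵇ-sound α (proj₂ (∈-filter⁻ (T? ∘ injectiveᵇ) {xs = allMaps n n} α∈))

∈-bijections⁺ : ∀ {n} {α : Vec (Fin n) n} → Injective _≡_ _≡_ (lookup α) → α ∈ bijections n
∈-bijections⁺ {α = α} inj = ∈-filter⁺ (T? ∘ injectiveᵇ) (allMaps-complete α) (injectiveᵇ-complete α inj)

relabel : ∀ {A : Set} {n} → (Fin n → Fin n) → Vec A n → Vec A n
relabel f α = tabulate (lookup α ∘ f)

lookup-relabel : ∀ {A : Set} {n} (f : Fin n → Fin n) (α : Vec A n) k →
  lookup (relabel f α) k ≡ lookup α (f k)
lookup-relabel f α = lookup∘tabulate (lookup α ∘ f)

relabel-inverse : ∀ {A : Set} {n} {f g : Fin n → Fin n} → (∀ k → f (g k) ≡ k) →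
  ∀ (α : Vec A n) → relabel g (relabel f α) ≡ α
relabel-inverse {f = f} {g} fg α = ≡-trans
  (tabulate-cong (λ k → ≡-trans (lookup-relabel f α (g k)) (cong (lookup α) (fg k))))
  (tabulate∘lookup α)

relabel-injective : ∀ {A : Set} {n} (f g : Fin n → Fin n) → (∀ k → g (f k) ≡ k) →
  ∀ (α : Vec A n) → Injective _≡_ _≡_ (lookup α) → Injective _≡_ _≡_ (lookup (relabel f α))
relabel-injective f g gf α inj {k} {l} eq = begin
  k            ≡⟨ sym (gf k) ⟩
  g (f k)      ≡⟨ cong g (inj (≡-trans (sym (lookup-relabel f α k))
                                         (≡-trans eq (lookup-relabel f α l)))) ⟩
  g (f l)      ≡⟨ gf l ⟩
  l            ∎
  where open ≡-Reasoning

sumList-bijections-relabel : ∀ {n} (π : Permutation′ n) (g : Vec (Fin n) n → ℤ) →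
  sumList g (bijections n) ≡ sumList (g ∘ relabel (π ⟨$⟩ʳ_)) (bijections n)
sumList-bijections-relabel {n} π g = sumList-reindex g (relabel (π ⟨$⟩ʳ_)) (relabel (π ⟨$⟩ˡ_))
  (bijections-unique n) (relabel-inverse (λ _ → inverseˡ π)) (relabel-inverse (λ _ → inverseʳ π))
  (λ {α} α∈ → ∈-bijections⁺
    (relabel-injective (π ⟨$⟩ʳ_) (π ⟨$⟩ˡ_) (λ _ → inverseˡ π) α (∈-bijections⁻ α∈)))
  (λ {α} α∈ → ∈-bijections⁺
    (relabel-injective (π ⟨$⟩ˡ_) (π ⟨$⟩ʳ_) (λ _ → inverseʳ π) α (∈-bijections⁻ α∈)))

transpose-matchˡ : ∀ {n} (p q : Fin n) → transpose p q ⟨$⟩ʳ p ≡ q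
transpose-matchˡ p q rewrite dec-true (p ≟ p) refl = refl

transpose-matchʳ : ∀ {n} (p q : Fin n) → transpose p q ⟨$⟩ʳ q ≡ p
transpose-matchʳ p q with q ≟ p
... | yes refl = refl
... | no _ rewrite dec-true (q ≟ q) refl = refl

transpose-other : ∀ {n} {p q k : Fin n} → k ≢ p → k ≢ q → transpose p q ⟨$⟩ʳ k ≡ k
transpose-other {p = p} {q} {k} k≢p k≢q rewrite dec-false (k ≟ p) k≢p | dec-false (k ≟ q) k≢q = refl

#bijections : ℕ → ℤ
#bijections n = + length (bijections n)

-- Relative order and its correlations

sgn : ∀ {n} → Fin n → Fin n → ℤ
sgn a b = if ⌊ a <? b ⌋ then 1ℤ else -1ℤ

sgn-< : ∀ {n} {a b : Fin n} → a < b → sgn a b ≡ 1ℤ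
sgn-< {a = a} {b} a<b with a <? b
... | yes _   = refl
... | no a≮b = contradiction a<b a≮b

sgn-> : ∀ {n} {a b : Fin n} → b < a → sgn a b ≡ -1ℤ
sgn-> {a = a} {b} b<a with a <? b
... | yes a<b = contradiction a<b (<-asym b<a)
... | no _    = refl

sgn-square : ∀ {n} (a b : Fin n) → sgn a b * sgn a b ≡ 1ℤ
sgn-square a b with a <? b
... | yes _ = refl
... | no _  = refl

sgn-antisym : ∀ {n} {a b : Fin n} → a ≢ b → sgn b a ≡ - sgn a b
sgn-antisym {a = a} {b} a≢b with <-cmp a b
... | tri< a<b _ _ rewrite sgn-< a<b | sgn-> a<b = refl
... | tri≈ _ a≡b _ = contradiction a≡b a≢b
... | tri> _ _ b<a rewrite sgn-< b<a | sgn-> b<a = refl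

-- The least and the greatest of three points see the other two on one side, the middle one on both.
sgn-triple : ∀ {n} {a b c : Fin n} → a ≢ b → a ≢ c → b ≢ c →
  sgn a b * sgn a c + sgn b a * sgn b c + sgn c a * sgn c b ≡ 1ℤ
sgn-triple {a = a} {b} {c} a≢b a≢c b≢c
  rewrite sgn-antisym a≢b | sgn-antisym a≢c | sgn-antisym b≢c
  with <-cmp a b | <-cmp a c | <-cmp b c
... | tri≈ _ a≡b _ | _ | _ = contradiction a≡b a≢b
... | _ | tri≈ _ a≡c _ | _ = contradiction a≡c a≢c
... | _ | _ | tri≈ _ b≡c _ = contradiction b≡c b≢c
... | tri< a<b _ _ | tri> _ _ c<a | tri< b<c _ _ = contradiction (<-trans a<b b<c) (<-asym c<a)
... | tri> _ _ b<a | tri< a<c _ _ | tri> _ _ c<b = contradiction (<-trans c<b b<a) (<-asym a<c)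
... | tri< p _ _ | tri< q _ _ | tri< r _ _ rewrite sgn-< p | sgn-< q | sgn-< r = refl
... | tri< p _ _ | tri< q _ _ | tri> _ _ r rewrite sgn-< p | sgn-< q | sgn-> r = refl
... | tri< p _ _ | tri> _ _ q | tri> _ _ r rewrite sgn-< p | sgn-> q | sgn-> r = refl
... | tri> _ _ p | tri< q _ _ | tri< r _ _ rewrite sgn-> p | sgn-< q | sgn-< r = refl
... | tri> _ _ p | tri> _ _ q | tri< r _ _ rewrite sgn-> p | sgn-> q | sgn-< r = refl
... | tri> _ _ p | tri> _ _ q | tri> _ _ r rewrite sgn-> p | sgn-> q | sgn-> r = refl

module _ {n : ℕ} where

  order : Vec (Fin n) n → Fin n → Fin n → ℤ
  order α i j = sgn (lookup α i) (lookup α j)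

  corr : Fin n → Fin n → Fin n → Fin n → ℤ
  corr i j k l = sumList (λ α → order α i j * order α k l) (bijections n)

  order-antisym : ∀ {α i j} → α ∈ bijections n → i ≢ j → order α j i ≡ - order α i j
  order-antisym α∈ i≢j = sgn-antisym (i≢j ∘ ∈-bijections⁻ α∈)

  corr-relabel : ∀ (π : Permutation′ n) i j k l →
    corr i j k l ≡ corr (π ⟨$⟩ʳ i) (π ⟨$⟩ʳ j) (π ⟨$⟩ʳ k) (π ⟨$⟩ʳ l)
  corr-relabel π i j k l =
    ≡-trans (sumList-bijections-relabel π _) (sumList-cong (bijections n) λ {α} _ →
      cong₂ _*_ (cong₂ sgn (lookup-relabel f α i) (lookup-relabel f α j))
                (cong₂ sgn (lookup-relabel f α k) (lookup-relabel f α l)))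
    where
    f : Fin n → Fin n
    f = π ⟨$⟩ʳ_

  corr-transpose : ∀ p q {i j k l i′ j′ k′ l′} →
    transpose p q ⟨$⟩ʳ i ≡ i′ → transpose p q ⟨$⟩ʳ j ≡ j′ →
    transpose p q ⟨$⟩ʳ k ≡ k′ → transpose p q ⟨$⟩ʳ l ≡ l′ →
    corr i j k l ≡ corr i′ j′ k′ l′
  corr-transpose p q refl refl refl refl = corr-relabel (transpose p q) _ _ _ _

  corr-comm : ∀ i j k l → corr i j k l ≡ corr k l i j
  corr-comm i j k l = sumList-cong (bijections n) (λ {α} _ → *-comm (order α i j) (order α k l))

  corr-antisymˡ : ∀ {i j} k l → i ≢ j → corr j i k l ≡ - corr i j k l
  corr-antisymˡ {i} {j} k l i≢j = ≡-trans
    (sumList-cong (bijections n) λ {α} α∈ → ≡-trans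
      (cong (_* order α k l) (order-antisym α∈ i≢j))
      (sym (neg-distribˡ-* (order α i j) (order α k l))))
    (sumList-neg _ (bijections n))

  corr-antisymʳ : ∀ i j {k l} → k ≢ l → corr i j l k ≡ - corr i j k l
  corr-antisymʳ i j {k} {l} k≢l = begin
    corr i j l k    ≡⟨ corr-comm i j l k ⟩
    corr l k i j    ≡⟨ corr-antisymˡ i j k≢l ⟩
    - corr k l i j  ≡⟨ cong -_ (corr-comm k l i j) ⟩
    - corr i j k l  ∎
    where open ≡-Reasoning

  corr-diagonal : ∀ i j → corr i j i j ≡ #bijections n
  corr-diagonal i j = ≡-trans
    (sumList-cong (bijections n) (λ {α} _ → sgn-square (lookup α i) (lookup α j)))
    (sumList-1≡length (bijections n))

  corr-disjoint : ∀ {i j k l} → i ≢ j → k ≢ i → k ≢ j → l ≢ i → l ≢ j → corr i j k l ≡ 0ℤ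
  corr-disjoint {i} {j} {k} {l} i≢j k≢i k≢j l≢i l≢j = x≡-x⇒x≡0 (begin
    corr i j k l    ≡⟨ corr-transpose i j (transpose-matchˡ i j) (transpose-matchʳ i j)
                         (transpose-other k≢i k≢j) (transpose-other l≢i l≢j) ⟩
    corr j i k l    ≡⟨ corr-antisymˡ k l i≢j ⟩
    - corr i j k l  ∎)
    where open ≡-Reasoning

  -- Transposing i with j, resp. with l, turns corr i j i l into the other two terms of sgn-triple.
  corr-sharedTail : ∀ {i j l} → i ≢ j → i ≢ l → j ≢ l → + 3 * corr i j i l ≡ #bijections n
  corr-sharedTail {i} {j} {l} i≢j i≢l j≢l = begin
    + 3 * corr i j i l                          ≡⟨ thrice (corr i j i l) ⟩
    corr i j i l + corr i j i l + corr i j i l  ≡⟨ cong₂ (λ x y → corr i j i l + x + y) swap-ij swap-il ⟩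
    corr i j i l + corr j i j l + corr l i l j  ≡⟨ sym sumList-rankSum ⟩
    sumList rankSum (bijections n)              ≡⟨ sumList-cong (bijections n) rankSum≡1 ⟩
    sumList (λ _ → 1ℤ) (bijections n)           ≡⟨ sumList-1≡length (bijections n) ⟩
    #bijections n                               ∎
    where
    open ≡-Reasoning
    thrice : ∀ x → + 3 * x ≡ x + x + x
    thrice = solve-∀
    swap-ij : corr i j i l ≡ corr j i j l
    swap-ij = corr-transpose i j (transpose-matchˡ i j) (transpose-matchʳ i j) (transpose-matchˡ i j)
                (transpose-other (i≢l ∘ sym) (j≢l ∘ sym))
    swap-il : corr i j i l ≡ corr l i l j
    swap-il = ≡-trans (corr-transpose i l (transpose-matchˡ i l) (transpose-other (i≢j ∘ sym) j≢l)
                                          (transpose-matchˡ i l) (transpose-matchʳ i l))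
                      (corr-comm l j l i)
    rankSum : Vec (Fin n) n → ℤ
    rankSum α = order α i j * order α i l + order α j i * order α j l + order α l i * order α l j
    sumList-rankSum : sumList rankSum (bijections n) ≡ corr i j i l + corr j i j l + corr l i l j
    sumList-rankSum =
      ≡-trans (sumList-+ _ _ (bijections n)) (cong (_+ corr l i l j) (sumList-+ _ _ (bijections n)))
    rankSum≡1 : ∀ {α} → α ∈ bijections n → rankSum α ≡ 1ℤ
    rankSum≡1 {α} α∈ = sgn-triple (i≢j ∘ inj) (i≢l ∘ inj) (j≢l ∘ inj)
      where
      inj : Injective _≡_ _≡_ (lookup α)
      inj = ∈-bijections⁻ α∈

  corr-headToTail : ∀ {i j l} → i ≢ j → i ≢ l → j ≢ l → + 3 * corr i j j l ≡ - #bijections n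
  corr-headToTail {i} {j} {l} i≢j i≢l j≢l = begin
    + 3 * corr i j j l        ≡⟨ cong (_*_ (+ 3)) (corr-antisymˡ j l (i≢j ∘ sym)) ⟩
    + 3 * - corr j i j l      ≡⟨ sym (neg-distribʳ-* (+ 3) (corr j i j l)) ⟩
    - (+ 3 * corr j i j l)    ≡⟨ cong -_ (corr-sharedTail (i≢j ∘ sym) j≢l i≢l) ⟩
    - #bijections n           ∎
    where open ≡-Reasoning

  corr-tailToHead : ∀ {i j k} → i ≢ j → i ≢ k → j ≢ k → + 3 * corr i j k i ≡ - #bijections n
  corr-tailToHead {i} {j} {k} i≢j i≢k j≢k = begin
    + 3 * corr i j k i        ≡⟨ cong (_*_ (+ 3)) (corr-antisymʳ i j i≢k) ⟩
    + 3 * - corr i j i k      ≡⟨ sym (neg-distribʳ-* (+ 3) (corr i j i k)) ⟩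
    - (+ 3 * corr i j i k)    ≡⟨ cong -_ (corr-sharedTail i≢j i≢k j≢k) ⟩
    - #bijections n           ∎
    where open ≡-Reasoning

  corr-sharedHead : ∀ {i j k} → i ≢ j → i ≢ k → j ≢ k → + 3 * corr i j k j ≡ #bijections n
  corr-sharedHead {i} {j} {k} i≢j i≢k j≢k = begin
    + 3 * corr i j k j        ≡⟨ cong (_*_ (+ 3)) (corr-antisymˡ k j (i≢j ∘ sym)) ⟩
    + 3 * - corr j i k j      ≡⟨ cong (λ x → + 3 * - x) (corr-antisymʳ j i j≢k) ⟩
    + 3 * - - corr j i j k    ≡⟨ cong (_*_ (+ 3)) (neg-involutive (corr j i j k)) ⟩
    + 3 * corr j i j k        ≡⟨ corr-sharedTail (i≢j ∘ sym) j≢k i≢k ⟩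
    #bijections n             ∎
    where open ≡-Reasoning

  -- 3 · corr i j k l / #bijections n, as a function of which endpoints of ij and kl coincide.
  corrPattern : Fin n → Fin n → Fin n → Fin n → ℤ
  corrPattern i j k l = (δ k i - δ k j) - (δ l i - δ l j) + (δ k i * δ l j - δ k j * δ l i)

  -- Splitting on the four comparisons k ≟ i, k ≟ j, l ≟ i, l ≟ j also evaluates every δ in corrPattern.
  corr-formula : ∀ {i j k l} → i ≢ j → k ≢ l → + 3 * corr i j k l ≡ #bijections n * corrPattern i j k l
  corr-formula {i} {j} {k} {l} i≢j k≢l with k ≟ i | k ≟ j | l ≟ i | l ≟ j
  ... | yes refl | yes refl | _        | _        = contradiction refl i≢j
  ... | _        | _        | yes refl | yes refl = contradiction refl i≢j
  ... | yes refl | _        | yes refl | _        = contradiction refl k≢l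
  ... | _        | yes refl | _        | yes refl = contradiction refl k≢l
  corr-formula {i} {j} {.i} {.j} i≢j _ | yes refl | no _ | no _ | yes refl =
    ≡-trans (cong (_*_ (+ 3)) (corr-diagonal i j)) (*-comm (+ 3) (#bijections n))
  corr-formula {i} {j} {.j} {.i} i≢j _ | no _ | yes refl | yes refl | no _ =
    ≡-trans (cong (_*_ (+ 3)) (≡-trans (corr-antisymˡ j i (i≢j ∘ sym)) (cong -_ (corr-diagonal j i))))
            (3*-x≡x*-3 (#bijections n))
  corr-formula {i} {j} {.i} {l} i≢j i≢l | yes refl | no _ | no _ | no l≢j =
    ≡-trans (corr-sharedTail i≢j i≢l (l≢j ∘ sym)) (sym (*-identityʳ (#bijections n)))
  corr-formula {i} {j} {.j} {l} i≢j j≢l | no _ | yes refl | no l≢i | no _ =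
    ≡-trans (corr-headToTail i≢j (l≢i ∘ sym) j≢l) (-x≡x*-1 (#bijections n))
  corr-formula {i} {j} {k} {.i} i≢j k≢i | no _ | no k≢j | yes refl | no _ =
    ≡-trans (corr-tailToHead i≢j (k≢i ∘ sym) (k≢j ∘ sym)) (-x≡x*-1 (#bijections n))
  corr-formula {i} {j} {k} {.j} i≢j k≢j | no k≢i | no _ | no _ | yes refl =
    ≡-trans (corr-sharedHead i≢j (k≢i ∘ sym) (k≢j ∘ sym)) (sym (*-identityʳ (#bijections n)))
  corr-formula {i} {j} {k} {l} i≢j _ | no k≢i | no k≢j | no l≢i | no l≢j =
    ≡-trans (cong (_*_ (+ 3)) (corr-disjoint i≢j k≢i k≢j l≢i l≢j)) (sym (*-zeroʳ (#bijections n)))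

-- The weighted oriented graph

module _ {n : ℕ} (D : WeightedOrientedGraph n) where

  w : Fin n → Fin n → ℤ
  w i j = if arc D i j then + weight D i j else 0ℤ

  w-diagonal : ∀ i → w i i ≡ 0ℤ
  w-diagonal i rewrite loopless D i = refl

  w*w-reverse : ∀ i j → w i j * w j i ≡ 0ℤ
  w*w-reverse i j with arc D i j in ij∈A
  ... | false = refl
  ... | true rewrite no2cycle D i j ij∈A = *-zeroʳ (+ weight D i j)

  w-*-congOffDiagonal : ∀ {f g : Fin n → Fin n → ℤ} → (∀ {i j} → i ≢ j → f i j ≡ g i j) →
    ∀ i j → w i j * f i j ≡ w i j * g i j
  w-*-congOffDiagonal f≡g i j with i ≟ j
  ... | yes refl rewrite w-diagonal i = refl
  ... | no i≢j   = cong (_*_ (w i j)) (f≡g i≢j)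

  W2≡∑∑w² : W2 D ≡ ∑∑ (λ i j → w i j * w i j)
  W2≡∑∑w² = sumFin²≡∑∑ entry
    where
    entry : ∀ i j → (if arc D i j then + (weight D i j ℕ.* weight D i j) else 0ℤ) ≡ w i j * w i j
    entry i j with arc D i j
    ... | false = refl
    ... | true  = pos-* (weight D i j) (weight D i j)

  twiceX≡∑∑w·order : ∀ α → twiceX D α ≡ ∑∑ (λ i j → w i j * order α i j)
  twiceX≡∑∑w·order α = sumFin²≡∑∑ entry
    where
    entry : ∀ i j → (if arc D i j then epsilon D α i j else 0ℤ) ≡ w i j * order α i j
    entry i j with arc D i j
    ... | false = refl
    ... | true  = if-neg≡*sign ⌊ lookup α i <? lookup α j ⌋ (+ weight D i j)

  sumFourXsq≡∑∑corr : sumFourXsq D ≡ ∑∑ (λ i j → w i j * ∑∑ (λ k l → w k l * corr i j k l))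
  sumFourXsq≡∑∑corr = begin
    sumFourXsq D
      ≡⟨ sumList-cong (bijections n) (λ {α} _ →
           ≡-trans (cong₂ _*_ (twiceX≡∑∑w·order α) (twiceX≡∑∑w·order α)) (∑∑-*-∑∑ (w·order α) (w·order α))) ⟩
    sumList (λ α → ∑∑ (λ i j → ∑∑ (λ k l → w·order α i j * w·order α k l))) (bijections n)
      ≡⟨ sumList-∑∑ {n = n} _ (bijections n) ⟩
    ∑∑ (λ i j → sumList (λ α → ∑∑ (λ k l → w·order α i j * w·order α k l)) (bijections n))
      ≡⟨ ∑∑-cong {n} (λ i j → sumList-∑∑ {n = n} _ (bijections n)) ⟩
    ∑∑ (λ i j → ∑∑ (λ k l → sumList (λ α → w·order α i j * w·order α k l) (bijections n)))
      ≡⟨ ∑∑-cong {n} (λ i j → ∑∑-cong {n} (λ k l → ≡-trans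
           (sumList-cong (bijections n) λ {α} _ →
              *-interchange (w i j) (order α i j) (w k l) (order α k l))
           (sumList-*ˡ (w i j * w k l) _ (bijections n)))) ⟩
    ∑∑ (λ i j → ∑∑ (λ k l → w i j * w k l * corr i j k l))
      ≡⟨ ∑∑-cong {n} (λ i j → ≡-trans (∑∑-cong {n} (λ k l → *-assoc (w i j) (w k l) (corr i j k l)))
                                       (sym (*-distribˡ-∑∑ (w i j) (λ k l → w k l * corr i j k l)))) ⟩
    ∑∑ (λ i j → w i j * ∑∑ (λ k l → w k l * corr i j k l))
      ∎
    where
    open ≡-Reasoning
    w·order : Vec (Fin n) n → Fin n → Fin n → ℤ
    w·order α i j = w i j * order α i j

  arcTotal : Fin n → Fin n → ℤ
  arcTotal i j = divergence w i - divergence w j + (w i j - w j i)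

  arcCorrelations : ∀ {i j} → i ≢ j →
    + 3 * ∑∑ (λ k l → w k l * corr i j k l) ≡ #bijections n * arcTotal i j
  arcCorrelations {i} {j} i≢j = begin
    + 3 * ∑∑ (λ k l → w k l * corr i j k l)
      ≡⟨ *-distribˡ-∑∑-weighted (+ 3) w (corr i j) ⟩
    ∑∑ (λ k l → w k l * (+ 3 * corr i j k l))
      ≡⟨ ∑∑-cong {n} (w-*-congOffDiagonal (corr-formula i≢j)) ⟩
    ∑∑ (λ k l → w k l * (#bijections n * corrPattern i j k l))
      ≡⟨ sym (*-distribˡ-∑∑-weighted (#bijections n) w (corrPattern i j)) ⟩
    #bijections n * ∑∑ (λ k l → w k l * corrPattern i j k l)
      ≡⟨ cong (_*_ (#bijections n)) (begin
           ∑∑ (λ k l → w k l * corrPattern i j k l)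
             ≡⟨ ∑∑-cong {n} (λ k l → *-distribˡ-+ (w k l) (c k - c l) (coincidence k l)) ⟩
           ∑∑ (λ k l → w k l * (c k - c l) + w k l * coincidence k l)
             ≡⟨ ∑∑-distrib-+ (λ k l → w k l * (c k - c l)) (λ k l → w k l * coincidence k l) ⟩
           ∑∑ (λ k l → w k l * (c k - c l)) + ∑∑ (λ k l → w k l * coincidence k l)
             ≡⟨ cong₂ _+_ (≡-trans (∑∑-gradient w c) (∑-[δ-δ] (divergence w) i j)) coincidences ⟩
           arcTotal i j
             ∎) ⟩
    #bijections n * arcTotal i j
      ∎
    where
    open ≡-Reasoning
    c : Fin n → ℤ
    c v = δ v i - δ v j
    coincidence : Fin n → Fin n → ℤ
    coincidence k l = δ k i * δ l j - δ k j * δ l i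
    coincidences : ∑∑ (λ k l → w k l * coincidence k l) ≡ w i j - w j i
    coincidences = begin
      ∑∑ (λ k l → w k l * coincidence k l)
        ≡⟨ ∑∑-cong {n} (λ k l → x[y-z]≈xy-xz (w k l) (δ k i * δ l j) (δ k j * δ l i)) ⟩
      ∑∑ (λ k l → w k l * (δ k i * δ l j) - w k l * (δ k j * δ l i))
        ≡⟨ ∑∑-distrib-- (λ k l → w k l * (δ k i * δ l j)) (λ k l → w k l * (δ k j * δ l i)) ⟩
      ∑∑ (λ k l → w k l * (δ k i * δ l j)) - ∑∑ (λ k l → w k l * (δ k j * δ l i))
        ≡⟨ cong₂ _-_ (∑∑-δδ w i j) (∑∑-δδ w j i) ⟩
      w i j - w j i
        ∎

  ∑∑-w*arcTotal : ∑∑ (λ i j → w i j * arcTotal i j) ≡ W2 D + ∑[ v < n ] (divergence w v * divergence w v)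
  ∑∑-w*arcTotal = begin
    ∑∑ (λ i j → w i j * arcTotal i j)
      ≡⟨ ∑∑-cong {n} (λ i j → *-distribˡ-+ (w i j) (div i - div j) (w i j - w j i)) ⟩
    ∑∑ (λ i j → w i j * (div i - div j) + w i j * (w i j - w j i))
      ≡⟨ ∑∑-distrib-+ (λ i j → w i j * (div i - div j)) (λ i j → w i j * (w i j - w j i)) ⟩
    ∑∑ (λ i j → w i j * (div i - div j)) + ∑∑ (λ i j → w i j * (w i j - w j i))
      ≡⟨ cong (_+_ (∑∑ (λ i j → w i j * (div i - div j)))) (begin
           ∑∑ (λ i j → w i j * (w i j - w j i))
             ≡⟨ ∑∑-cong {n} (λ i j → x[y-z]≈xy-xz (w i j) (w i j) (w j i)) ⟩
           ∑∑ (λ i j → w i j * w i j - w i j * w j i)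
             ≡⟨ ∑∑-distrib-- (λ i j → w i j * w i j) (λ i j → w i j * w j i) ⟩
           ∑∑ (λ i j → w i j * w i j) - ∑∑ (λ i j → w i j * w j i)
             ≡⟨ cong₂ _-_ (sym W2≡∑∑w²) (≡-trans (∑∑-cong {n} w*w-reverse) (∑∑-zero n)) ⟩
           W2 D - 0ℤ
             ≡⟨ +-identityʳ (W2 D) ⟩
           W2 D
             ∎) ⟩
    ∑∑ (λ i j → w i j * (div i - div j)) + W2 D
      ≡⟨ cong (_+ W2 D) (∑∑-gradient w div) ⟩
    ∑[ v < n ] (div v * div v) + W2 D
      ≡⟨ +-comm (∑[ v < n ] (div v * div v)) (W2 D) ⟩
    W2 D + ∑[ v < n ] (div v * div v)
      ∎
    where
    open ≡-Reasoning
    div : Fin n → ℤ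
    div = divergence w

  sumFourXsq-formula :
    + 3 * sumFourXsq D ≡ #bijections n * (W2 D + ∑[ v < n ] (divergence w v * divergence w v))
  sumFourXsq-formula = begin
    + 3 * sumFourXsq D
      ≡⟨ cong (_*_ (+ 3)) sumFourXsq≡∑∑corr ⟩
    + 3 * ∑∑ (λ i j → w i j * ∑∑ (λ k l → w k l * corr i j k l))
      ≡⟨ *-distribˡ-∑∑-weighted (+ 3) w (λ i j → ∑∑ (λ k l → w k l * corr i j k l)) ⟩
    ∑∑ (λ i j → w i j * (+ 3 * ∑∑ (λ k l → w k l * corr i j k l)))
      ≡⟨ ∑∑-cong {n} (w-*-congOffDiagonal arcCorrelations) ⟩
    ∑∑ (λ i j → w i j * (#bijections n * arcTotal i j))
      ≡⟨ sym (*-distribˡ-∑∑-weighted (#bijections n) w arcTotal) ⟩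
    #bijections n * ∑∑ (λ i j → w i j * arcTotal i j)
      ≡⟨ cong (_*_ (#bijections n)) ∑∑-w*arcTotal ⟩
    #bijections n * (W2 D + ∑[ v < n ] (divergence w v * divergence w v))
      ∎
    where open ≡-Reasoning

lemma4 : (n : ℕ) (D : WeightedOrientedGraph n) →
    (+ 4 * + length (bijections n)) * W2 D ≤ + 12 * sumFourXsq D
lemma4 n D = begin
  (+ 4 * N) * W2 D                   ≡⟨ *-assoc (+ 4) N (W2 D) ⟩
  + 4 * (N * W2 D)                   ≤⟨ *-monoˡ-≤-nonNeg (+ 4) (*-monoˡ-≤-nonNeg N W2≤W2+∑div²) ⟩
  + 4 * (N * (W2 D + ∑div²))         ≡⟨ cong (_*_ (+ 4)) (sym (sumFourXsq-formula D)) ⟩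
  + 4 * (+ 3 * sumFourXsq D)         ≡⟨ sym (*-assoc (+ 4) (+ 3) (sumFourXsq D)) ⟩
  + 12 * sumFourXsq D                ∎
  where
  open ≤-Reasoning
  N : ℤ
  N = #bijections n
  div : Fin n → ℤ
  div = divergence (w D)
  ∑div² : ℤ
  ∑div² = ∑[ v < n ] (div v * div v)
  W2≤W2+∑div² : W2 D ≤ W2 D + ∑div²
  W2≤W2+∑div² = i≤i+j (W2 D) ∑div² ⦃ nonNegative (∑-nonNeg _ (square-nonNeg ∘ div)) ⦄
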